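{- Let $D=(E,\mathcal{F})$ be a vf-safe delta-matroid. Then (1) ${}^{\partial}w_{D}^{\times}(z)=cz^{m}$ for some constant $c$ and integer $m$ (i.e. the polynomial has only one term) if and only if $\mathcal{F}=\{E\}$; (2) ${}^{\partial}w_{D}^{*\times*}(z)=cz^{m}$ for some constant $c$ and integer $m$ if and only if $\mathcal{F}=\{\emptyset\}$.
   Context: A delta-matroid is a set system $D=(E,\mathcal{F})$ ($E$ finite, $\mathcal{F}\neq\emptyset$ a collection of subsets of $E$) such that for all $X,Y\in\mathcal{F}$ and $u\in X\Delta Y$ there is $v\in X\Delta Y$ (possibly $v=u$) with $X\Delta\{u,v\}\in\mathcal{F}$. For $A\subseteq E$, $D^{*|A}=(E,\{A\Delta X:X\in\mathcal{F}\})$; for $e\in E$, $D^{\times|e}=(E,\mathcal{F}\Delta\{F\cup e:F\in\mathcal{F},e\notin F\})$. For a word $a=a_1\cdots a_n$ in $\{*,\times\}$, $D^{a|e}$ means applying $a_1|e$, $a_2|e$, … in turn, and $D^{a|A}$ for $A=\{e_1,\dots,e_m\}$ means applying $a|e_1,\dots,a|e_m$ in turn. $D$ is vf-safe if every sequence of twists and loop complementations applied to it yields a delta-matroid. The width $w(D)$ is the maximum minus minimum size of a feasible set, and ${}^{\partial}w_{D}^{\bullet}(z)=\sum_{A\subseteq E}z^{w(D^{\bullet|A})}$. -}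

module Defs where

open import Data.Bool using (Bool; true; false; _xor_; if_then_else_)
open import Data.Nat using (ℕ; zero; suc; _∸_; _⊔_; _⊓_)
open import Data.Fin using (Fin)
open import Data.Fin.Subset using (Subset; ⁅_⁆; _∈_; _∪_; ∣_∣; ⊤; ⊥)
open import Data.Vec using (Vec; []; _∷_; zipWith; lookup; updateAt)
open import Data.List using (List; []; _∷_; map; _++_; foldr; length; filter; upTo)
open import Data.Product using (Σ; _×_; ∃; ∃-syntax)
open import Relation.Binary.PropositionalEquality using (_≡_)
open import Relation.Nullary.Decidable using (does)
import Data.Nat as ℕ

-- Ground set E = Fin n; a subset of E is a 'Subset n' (a Bool vector).
-- A set system (E, F) is represented by the characteristic function of F.
SetSystem : ℕ → Set
SetSystem n = Subset n → Bool

Feasible : ∀ {n} → SetSystem n → Subset n → Set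
Feasible F X = F X ≡ true

_Δ_ : ∀ {n} → Subset n → Subset n → Subset n
_Δ_ = zipWith _xor_

IsDeltaMatroid : ∀ {n} → SetSystem n → Set
IsDeltaMatroid {n} F =
  (∃[ X ] Feasible F X) ×
  (∀ (X Y : Subset n) → Feasible F X → Feasible F Y →
     ∀ (u : Fin n) → u ∈ (X Δ Y) →
       ∃[ v ] (v ∈ (X Δ Y) × Feasible F (X Δ (⁅ u ⁆ ∪ ⁅ v ⁆))))

-- twist D^{*|A}: feasible sets are A Δ X for X ∈ F
twist : ∀ {n} → Subset n → SetSystem n → SetSystem n
twist A F Y = F (A Δ Y)

-- loop complementation D^{×|e}: F Δ {X ∪ e : X ∈ F, e ∉ X}.
-- A set Y with e ∉ Y is feasible iff Y ∈ F; a set Y with e ∈ Y is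
-- feasible iff exactly one of Y ∈ F and (Y - e) ∈ F holds.
loopc : ∀ {n} → Fin n → SetSystem n → SetSystem n
loopc e F Y = if lookup Y e then (F Y xor F (updateAt Y e (λ _ → false))) else F Y

data Op (n : ℕ) : Set where
  tw : Subset n → Op n
  lc : Fin n → Op n

applyOp : ∀ {n} → Op n → SetSystem n → SetSystem n
applyOp (tw A) = twist A
applyOp (lc e) = loopc e

applyOps : ∀ {n} → List (Op n) → SetSystem n → SetSystem n
applyOps []         F = F
applyOps (o ∷ os)   F = applyOps os (applyOp o F)

VfSafe : ∀ {n} → SetSystem n → Set
VfSafe F = ∀ ops → IsDeltaMatroid (applyOps ops F)

data Letter : Set where
  `* `× : Letter

Word : Set
Word = List Letter

-- D^{a|e}: apply the letters of a at e in turn (*|e is the twist by {e})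
applyWordAt : ∀ {n} → Word → Fin n → SetSystem n → SetSystem n
applyWordAt []          e F = F
applyWordAt (`* ∷ a)    e F = applyWordAt a e (twist ⁅ e ⁆ F)
applyWordAt (`× ∷ a)    e F = applyWordAt a e (loopc e F)

allSubsets : ∀ n → List (Subset n)
allSubsets zero    = [] ∷ []
allSubsets (suc n) = map (false ∷_) (allSubsets n) ++ map (true ∷_) (allSubsets n)

allFin : ∀ n → List (Fin n)
allFin n = Data.List.tabulate (λ i → i)

elems : ∀ {n} → Subset n → List (Fin n)
elems {n} A = filter (λ i → Data.Bool._≟_ (lookup A i) true) (allFin n)

-- D^{a|A}: apply a|e_1, ..., a|e_m in turn, A = {e_1 < ... < e_m}
applyWordSet : ∀ {n} → Word → Subset n → SetSystem n → SetSystem n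
applyWordSet a A F = foldr (λ e G → applyWordAt a e G) F (Data.List.reverse (elems A))

-- width: max minus min size of a feasible set (0 if there is none)
width : ∀ {n} → SetSystem n → ℕ
width {n} F = foldr _⊔_ 0 sizes ∸ foldr _⊓_ n sizes
  where
  sizes : List ℕ
  sizes = map ∣_∣ (filter (λ X → Data.Bool._≟_ (F X) true) (allSubsets n))

-- the polynomial ∂w_D^a(z) = Σ_{A ⊆ E} z^{w(D^{a|A})}, represented by its
-- coefficient sequence: coefficient of z^k
partialWidthPoly : ∀ {n} → Word → SetSystem n → ℕ → ℕ
partialWidthPoly {n} a F k =
  length (filter (λ A → width (applyWordSet a A F) ℕ.≟ k) (allSubsets n))

IsMonomial : (ℕ → ℕ) → Set
IsMonomial p = ∃[ c ] ∃[ m ] (∀ k → p k ≡ (if does (k ℕ.≟ m) then c else 0))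

IsSingletonFamily : ∀ {n} → SetSystem n → Subset n → Set
IsSingletonFamily {n} F S = ∀ (X : Subset n) → (Feasible F X → X ≡ S) × (X ≡ S → Feasible F X)

-- Suppose F has a feasible set other than E and let X be one of maximum size.  Loop-complement
-- at the elements outside X one at a time.  Among the sets containing X, the feasible ones are
-- then always exactly those covered by X and the elements processed so far; hence E changes
-- feasibility exactly once, at the last step.  Meanwhile a smallest feasible set stays
-- smallest, so the largest feasible size, and with it the width, changes: ∂w^× has two terms.
-- Conversely loop complementation fixes {E}.  Part (2) is part (1) for the dual D^{*|E}, since
-- complementation conjugates ×|e into *×*|e and preserves widths.
module Submission where

open import Defs
open import Data.Product using (_×_)
open import Data.Nat using (ℕ)
open import Data.List using (_∷_; [])
open import Data.Fin.Subset using (⊤; ⊥)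
open import Function.Bundles using (_⇔_)

open import Data.Bool using (Bool; true; false; not; _xor_; if_then_else_)
open import Data.Bool.Properties using (xor-same; xor-assoc; xor-identityʳ; xor-comm; not-involutive; ¬-not)
import Data.Bool as Bool
open import Data.Fin using (Fin; zero; suc)
import Data.Fin as Fin
open import Data.Fin.Subset using (Subset; _∈_; _∉_; _⊆_; ∁; _-_; ⁅_⁆; ∣_∣)
open import Data.Fin.Subset.Properties
  using (_∈?_; anySubset?; ∈⊤; ∉⊥; ⊆⊤; ⊆-antisym; p─⊥≡p; p─q⊆p; x∈p∧x≢y⇒x∈p-y; x∈∁p⇒x∉p; x∉p⇒x∈∁p;
         ∣p∣≤n; ∣⊤∣≡n; ∣p∣≡n⇒p≡⊤; ∣∁p∣≡n∸∣p∣; p⊆q⇒∣p∣≤∣q∣; p⊂q⇒∣p∣<∣q∣; x∈p⇒∣p-x∣<∣p∣; ∪-∩-booleanAlgebra)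
import Algebra.Lattice.Properties.BooleanAlgebra as BooleanAlgebraProperties
open import Data.Nat using (_≤_; _<_; _∸_; _+_; _⊔_; _⊓_; z≤n)
import Data.Nat as ℕ
open import Data.Nat.Properties
  using (≤-antisym; ≤-trans; <-trans; ≤∧≢⇒<; <⇒≢; <⇒≱; ≮⇒≥; ∸-monoˡ-<; ∸-monoʳ-≤; 0∸n≡0;
         m∸n+n≡m; +-∸-assoc; m+n∸m≡n; ⊔-lub; ⊓-glb; m≤m⊔n; m≤n⊔m; m⊓n≤m; m⊓n≤n)
open import Data.Vec using ([]; _∷_; lookup; updateAt)
open import Data.Vec.Properties using (≡-dec; []=⇒lookup; lookup⇒[]=; lookup∘updateAt)
open import Data.List using (List; foldr; filter; length; map; reverse)
open import Data.List.Properties using (filter-≐; filter-all; filter-none; filter-some; foldr-preservesᵇ)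
open import Data.List.Extrema.Nat using (argmax; argmin; argmax-all; argmin-all; f[xs]≤f[argmax]; f[argmin]≤f[xs])
open import Data.List.Membership.Propositional using (lose) renaming (_∈_ to _∈ₗ_)
open import Data.List.Membership.Propositional.Properties
  using (∈-filter⁺; ∈-filter⁻; ∈-map⁺; ∈-++⁺ˡ; ∈-++⁺ʳ; ∈-tabulate⁺)
open import Data.List.Relation.Unary.All as All using (All; []; _∷_)
open import Data.List.Relation.Unary.All.Properties using (all-filter; All¬⇒¬Any) renaming (map⁺ to All-map⁺)
open import Data.List.Relation.Unary.Any using (here; there)
import Data.List.Relation.Unary.Any.Properties as Any
open import Data.List.Relation.Unary.Unique.Propositional using (Unique)
import Data.List.Relation.Unary.Unique.Propositional.Properties as Unique
open import Data.List.Relation.Unary.AllPairs using ([]; _∷_)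
open import Data.List.Relation.Binary.Permutation.Propositional using (↭-sym; ↭⇒↭ₛ)
open import Data.List.Relation.Binary.Permutation.Propositional.Properties using (↭-reverse)
import Data.List.Relation.Binary.Permutation.Setoid.Properties as PermutationProperties
open import Data.Product using (_,_; proj₁; proj₂; ∃-syntax)
open import Data.Sum using (_⊎_; inj₁; inj₂)
import Data.Sum as Sum
open import Function using (_∘_)
open import Function.Bundles using (mk⇔; Equivalence)
import Function.Properties.Equivalence as ⇔
open import Relation.Binary.PropositionalEquality
open import Relation.Nullary using (¬_; Dec; yes; no; does; contradiction)
open import Relation.Nullary.Decidable using (_×-dec_; ¬?)
open import Relation.Unary using (Pred; Decidable)
open import Level using (0ℓ)

private
  variable
    n : ℕ

_≟ₛ_ : (X Y : Subset n) → Dec (X ≡ Y)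
_≟ₛ_ = ≡-dec Bool._≟_

∁-involutive : (X : Subset n) → ∁ (∁ X) ≡ X
∁-involutive {n} = BooleanAlgebraProperties.¬-involutive (∪-∩-booleanAlgebra n)

∁-injective : {X Y : Subset n} → ∁ X ≡ ∁ Y → X ≡ Y
∁-injective {X = X} {Y} ∁X≡∁Y = trans (sym (∁-involutive X)) (trans (cong ∁ ∁X≡∁Y) (∁-involutive Y))

∁⊥≡⊤ : ∁ (⊥ {n}) ≡ ⊤
∁⊥≡⊤ {n} = BooleanAlgebraProperties.¬⊥≈⊤ (∪-∩-booleanAlgebra n)

[m∸n]∸[m∸o]≡o∸n : {m n o : ℕ} → n ≤ o → o ≤ m → (m ∸ n) ∸ (m ∸ o) ≡ o ∸ n
[m∸n]∸[m∸o]≡o∸n {m} {n} {o} n≤o o≤m = begin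
  (m ∸ n) ∸ (m ∸ o)              ≡⟨ cong (λ k → (k ∸ n) ∸ (m ∸ o)) (sym (m∸n+n≡m o≤m)) ⟩
  ((m ∸ o) + o ∸ n) ∸ (m ∸ o)    ≡⟨ cong (_∸ (m ∸ o)) (+-∸-assoc (m ∸ o) n≤o) ⟩
  ((m ∸ o) + (o ∸ n)) ∸ (m ∸ o)  ≡⟨ m+n∸m≡n (m ∸ o) (o ∸ n) ⟩
  o ∸ n                          ∎
  where open ≡-Reasoning

∣∁∣-antitone : (X Y : Subset n) → ∣ X ∣ ≤ ∣ Y ∣ → ∣ ∁ Y ∣ ≤ ∣ ∁ X ∣
∣∁∣-antitone {n} X Y X≤Y =
  subst₂ _≤_ (sym (∣∁p∣≡n∸∣p∣ Y)) (sym (∣∁p∣≡n∸∣p∣ X)) (∸-monoʳ-≤ n X≤Y)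

≢⊤⇒∣∣<n : {X : Subset n} → X ≢ ⊤ → ∣ X ∣ < n
≢⊤⇒∣∣<n {X = X} X≢⊤ = ≤∧≢⇒< (∣p∣≤n X) (X≢⊤ ∘ ∣p∣≡n⇒p≡⊤)

updateAt-false≡- : (Y : Subset n) (e : Fin n) → updateAt Y e (λ _ → false) ≡ Y - e
updateAt-false≡- (y ∷ Y) zero    = cong (false ∷_) (sym (p─⊥≡p Y))
updateAt-false≡- (y ∷ Y) (suc e) = cong (y ∷_) (updateAt-false≡- Y e)

x∉p-x : (Y : Subset n) (e : Fin n) → e ∉ Y - e
x∉p-x Y e e∈Y-e = contradiction false≡true λ ()
  where
  false≡true : false ≡ true
  false≡true = begin
    false                                  ≡⟨ sym (lookup∘updateAt e Y) ⟩
    lookup (updateAt Y e (λ _ → false)) e  ≡⟨ cong (λ Z → lookup Z e) (updateAt-false≡- Y e) ⟩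
    lookup (Y - e) e                       ≡⟨ []=⇒lookup e∈Y-e ⟩
    true                                   ∎
    where open ≡-Reasoning

p-x≢⊤ : (Y : Subset n) (e : Fin n) → Y - e ≢ ⊤
p-x≢⊤ Y e eq = x∉p-x Y e (subst (e ∈_) (sym eq) ∈⊤)

lookup≡false : {Y : Subset n} {e : Fin n} → e ∉ Y → lookup Y e ≡ false
lookup≡false {Y = Y} {e} e∉Y = ¬-not (e∉Y ∘ lookup⇒[]= e Y)

Δ-cancelˡ : (A Z : Subset n) → A Δ (A Δ Z) ≡ Z
Δ-cancelˡ []      []      = refl
Δ-cancelˡ (a ∷ A) (z ∷ Z) =
  cong₂ _∷_ (trans (sym (xor-assoc a a z)) (cong (_xor z) (xor-same a))) (Δ-cancelˡ A Z)

loopc-∈ : (G : SetSystem n) {e : Fin n} {Y : Subset n} → e ∈ Y → loopc e G Y ≡ (G Y xor G (Y - e))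
loopc-∈ G {e} {Y} e∈Y =
  cong₂ (λ b Z → if b then G Y xor G Z else G Y) ([]=⇒lookup e∈Y) (updateAt-false≡- Y e)

loopc-∉ : (G : SetSystem n) {e : Fin n} {Y : Subset n} → e ∉ Y → loopc e G Y ≡ G Y
loopc-∉ G {e} {Y} e∉Y =
  cong (λ b → if b then G Y xor G (updateAt Y e (λ _ → false)) else G Y) (lookup≡false e∉Y)

loopc-cong : (e : Fin n) {G H : SetSystem n} → (∀ Y → G Y ≡ H Y) → ∀ Y → loopc e G Y ≡ loopc e H Y
loopc-cong e G≗H Y =
  cong₂ (λ a b → if lookup Y e then a xor b else a) (G≗H Y) (G≗H (updateAt Y e (λ _ → false)))

loopcs : List (Fin n) → SetSystem n → SetSystem n
loopcs L G = foldr loopc G L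

∈-allSubsets : (X : Subset n) → X ∈ₗ allSubsets n
∈-allSubsets []                  = here refl
∈-allSubsets (false ∷ X)         = ∈-++⁺ˡ (∈-map⁺ (false ∷_) (∈-allSubsets X))
∈-allSubsets {ℕ.suc n} (true ∷ X) =
  ∈-++⁺ʳ (map (false ∷_) (allSubsets n)) (∈-map⁺ (true ∷_) (∈-allSubsets X))

∈-elems : {A : Subset n} {i : Fin n} → i ∈ A ⇔ i ∈ₗ elems A
∈-elems {n} {A} {i} = mk⇔
  (λ i∈A → ∈-filter⁺ (λ j → lookup A j Bool.≟ true) (∈-tabulate⁺ i) ([]=⇒lookup i∈A))
  (λ i∈elems → lookup⇒[]= i A (proj₂ (∈-filter⁻ (λ j → lookup A j Bool.≟ true) {xs = allFin n} i∈elems)))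

unique-elems : (A : Subset n) → Unique (elems A)
unique-elems {n} A = Unique.filter⁺ (λ j → lookup A j Bool.≟ true) (Unique.allFin⁺ n)

unique-reverse : {L : List (Fin n)} → Unique L → Unique (reverse L)
unique-reverse {n} {L} =
  PermutationProperties.Unique-resp-↭ (setoid (Fin n)) (↭⇒↭ₛ (↭-sym (↭-reverse L)))

elems-⊥ : elems (⊥ {n}) ≡ []
elems-⊥ {n} =
  filter-none (λ j → lookup ⊥ j Bool.≟ true) {xs = allFin n} (All.tabulate λ {j} _ → ∉⊥ ∘ lookup⇒[]= j ⊥)

applyWordSet-⊥ : (a : Word) (F : SetSystem n) → applyWordSet a ⊥ F ≡ F
applyWordSet-⊥ a F = cong (λ L → foldr (λ e G → applyWordAt a e G) F (reverse L)) elems-⊥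

-- Widths and the polynomial ∂w

feasibles : SetSystem n → List (Subset n)
feasibles {n} G = filter (λ X → G X Bool.≟ true) (allSubsets n)

spread : List (Subset n) → ℕ
spread {n} Xs = foldr _⊔_ 0 (map ∣_∣ Xs) ∸ foldr _⊓_ n (map ∣_∣ Xs)

∈-feasibles : (G : SetSystem n) {X : Subset n} → Feasible G X → X ∈ₗ feasibles G
∈-feasibles G {X} GX = ∈-filter⁺ (λ Y → G Y Bool.≟ true) (∈-allSubsets X) GX

foldr-⊔-greatest : {b : ℕ} (xs : List ℕ) → b ∈ₗ xs → All (_≤ b) xs → foldr _⊔_ 0 xs ≡ b
foldr-⊔-greatest xs b∈xs xs≤b = ≤-antisym (foldr-preservesᵇ ⊔-lub z≤n xs≤b) (below xs b∈xs)
  where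
  below : ∀ {b} xs → b ∈ₗ xs → b ≤ foldr _⊔_ 0 xs
  below (x ∷ xs) (here refl) = m≤m⊔n x _
  below (x ∷ xs) (there b∈xs) = ≤-trans (below xs b∈xs) (m≤n⊔m x _)

foldr-⊓-least : {a m : ℕ} (xs : List ℕ) → a ≤ m → a ∈ₗ xs → All (a ≤_) xs → foldr _⊓_ m xs ≡ a
foldr-⊓-least xs a≤m a∈xs a≤xs = ≤-antisym (above xs a∈xs) (foldr-preservesᵇ ⊓-glb a≤m a≤xs)
  where
  above : ∀ {a m} xs → a ∈ₗ xs → foldr _⊓_ m xs ≤ a
  above (x ∷ xs) (here refl) = m⊓n≤m x _
  above (x ∷ xs) (there a∈xs) = ≤-trans (m⊓n≤n x _) (above xs a∈xs)

width-between : (G : SetSystem n) {a b : Subset n} → Feasible G a → Feasible G b →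
                (∀ Y → Feasible G Y → ∣ a ∣ ≤ ∣ Y ∣ × ∣ Y ∣ ≤ ∣ b ∣) → width G ≡ ∣ b ∣ ∸ ∣ a ∣
width-between {n} G {a} {b} Ga Gb bounds =
  cong₂ _∸_ (foldr-⊔-greatest sizes (size∈ Gb) (All.map proj₂ sizes-within))
            (foldr-⊓-least sizes (∣p∣≤n a) (size∈ Ga) (All.map proj₁ sizes-within))
  where
  sizes : List ℕ
  sizes = map ∣_∣ (feasibles G)
  size∈ : ∀ {X} → Feasible G X → ∣ X ∣ ∈ₗ sizes
  size∈ GX = ∈-map⁺ ∣_∣ (∈-feasibles G GX)
  sizes-within : All (λ s → ∣ a ∣ ≤ s × s ≤ ∣ b ∣) sizes
  sizes-within = All-map⁺ (All.map (bounds _) (all-filter (λ X → G X Bool.≟ true) (allSubsets n)))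

width-empty : (G : SetSystem n) → (∀ X → ¬ Feasible G X) → width G ≡ 0
width-empty {n} G infeasible =
  trans (cong spread (filter-none (λ X → G X Bool.≟ true) {xs = allSubsets n}
                                  (All.tabulate λ {X} _ → infeasible X)))
        (0∸n≡0 n)

width-cong : {G H : SetSystem n} → (∀ X → G X ≡ H X) → width G ≡ width H
width-cong {n} {G} {H} G≗H =
  cong spread (filter-≐ (λ X → G X Bool.≟ true) (λ X → H X Bool.≟ true)
                        ((λ {X} → trans (sym (G≗H X))) , (λ {X} → trans (G≗H X))) (allSubsets n))

module _ {Q : Pred (Subset n) 0ℓ} (Q? : Decidable Q) where

  largest : {X : Subset n} → Q X → ∃[ b ] (Q b × (∀ Y → Q Y → ∣ Y ∣ ≤ ∣ b ∣))
  largest {X} QX =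
    argmax ∣_∣ X candidates ,
    argmax-all ∣_∣ QX (all-filter Q? (allSubsets n)) ,
    λ Y QY → All.lookup (f[xs]≤f[argmax] {f = ∣_∣} X candidates) (∈-filter⁺ Q? (∈-allSubsets Y) QY)
    where
    candidates = filter Q? (allSubsets n)

  smallest : {X : Subset n} → Q X → ∃[ a ] (Q a × (∀ Y → Q Y → ∣ a ∣ ≤ ∣ Y ∣))
  smallest {X} QX =
    argmin ∣_∣ X candidates ,
    argmin-all ∣_∣ QX (all-filter Q? (allSubsets n)) ,
    λ Y QY → All.lookup (f[argmin]≤f[xs] {f = ∣_∣} X candidates) (∈-filter⁺ Q? (∈-allSubsets Y) QY)
    where
    candidates = filter Q? (allSubsets n)

monomial⇔constant-width : (a : Word) (F : SetSystem n) →
  IsMonomial (partialWidthPoly a F) ⇔ (∀ A → width (applyWordSet a A F) ≡ width F)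
monomial⇔constant-width {n} a F = mk⇔ constant monomial
  where
  w : Subset n → ℕ
  w A = width (applyWordSet a A F)

  count-positive : ∀ A → 0 < partialWidthPoly a F (w A)
  count-positive A = filter-some (λ B → w B ℕ.≟ w A) (lose (∈-allSubsets A) refl)

  constant : IsMonomial (partialWidthPoly a F) → ∀ A → w A ≡ width F
  constant (c , m , poly≡) A =
    trans (only-m A) (sym (trans (cong width (sym (applyWordSet-⊥ a F))) (only-m ⊥)))
    where
    only-m : ∀ A → w A ≡ m
    only-m A = from-count (w A ℕ.≟ m) (poly≡ (w A))
      where
      from-count : (d : Dec (w A ≡ m)) → partialWidthPoly a F (w A) ≡ (if does d then c else 0) → w A ≡ m
      from-count (yes wA≡m) _       = wA≡m
      from-count (no _)     count≡0 = contradiction count≡0 (<⇒≢ (count-positive A) ∘ sym)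

  monomial : (∀ A → w A ≡ width F) → IsMonomial (partialWidthPoly a F)
  monomial w≡ = length (allSubsets n) , width F , count
    where
    count : ∀ k → partialWidthPoly a F k ≡ (if does (k ℕ.≟ width F) then length (allSubsets n) else 0)
    count k = counted (k ℕ.≟ width F)
      where
      counted : (d : Dec (k ≡ width F)) →
                partialWidthPoly a F k ≡ (if does d then length (allSubsets n) else 0)
      counted (yes k≡) = cong length (filter-all (λ B → w B ℕ.≟ k) {xs = allSubsets n}
                                                 (All.tabulate λ {A} _ → trans (w≡ A) (sym k≡)))
      counted (no k≢)  = cong length (filter-none (λ B → w B ℕ.≟ k) {xs = allSubsets n}
                                                  (All.tabulate λ {A} _ wA≡k → k≢ (trans (sym wA≡k) (w≡ A))))

-- Smallest feasible sets

IsSmallest : SetSystem n → Subset n → Set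
IsSmallest G Y₀ = Feasible G Y₀ × (∀ Y → ∣ Y ∣ < ∣ Y₀ ∣ → G Y ≡ false)

smallest-feasible : (G : SetSystem n) → ∃[ X ] Feasible G X → ∃[ Y₀ ] IsSmallest G Y₀
smallest-feasible G (X , GX) with smallest (λ Y → G Y Bool.≟ true) GX
... | Y₀ , GY₀ , Y₀≤ = Y₀ , GY₀ , λ Y Y<Y₀ → ¬-not λ GY → <⇒≱ Y<Y₀ (Y₀≤ Y GY)

IsSmallest⇒≤ : {G : SetSystem n} {Y₀ Y : Subset n} → IsSmallest G Y₀ → Feasible G Y → ∣ Y₀ ∣ ≤ ∣ Y ∣
IsSmallest⇒≤ (_ , below) GY = ≮⇒≥ λ Y<Y₀ → contradiction (trans (sym GY) (below _ Y<Y₀)) λ ()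

loopc-IsSmallest : (e : Fin n) {G : SetSystem n} {Y₀ : Subset n} →
                   IsSmallest G Y₀ → IsSmallest (loopc e G) Y₀
loopc-IsSmallest e {G} {Y₀} (GY₀ , below) = feasible , below′
  where
  feasible : loopc e G Y₀ ≡ true
  feasible with e ∈? Y₀
  ... | yes e∈Y₀ = trans (loopc-∈ G e∈Y₀) (cong₂ _xor_ GY₀ (below (Y₀ - e) (x∈p⇒∣p-x∣<∣p∣ e∈Y₀)))
  ... | no  e∉Y₀ = trans (loopc-∉ G e∉Y₀) GY₀
  below′ : ∀ Y → ∣ Y ∣ < ∣ Y₀ ∣ → loopc e G Y ≡ false
  below′ Y Y<Y₀ with e ∈? Y
  ... | yes e∈Y = trans (loopc-∈ G e∈Y)
                        (cong₂ _xor_ (below Y Y<Y₀) (below (Y - e) (<-trans (x∈p⇒∣p-x∣<∣p∣ e∈Y) Y<Y₀)))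
  ... | no  e∉Y = trans (loopc-∉ G e∉Y) (below Y Y<Y₀)

loopcs-IsSmallest : (L : List (Fin n)) {G : SetSystem n} {Y₀ : Subset n} →
                    IsSmallest G Y₀ → IsSmallest (loopcs L G) Y₀
loopcs-IsSmallest []      sG = sG
loopcs-IsSmallest (e ∷ L) sG = loopc-IsSmallest e (loopcs-IsSmallest L sG)

width-drops-without-⊤ : {G H : SetSystem n} {Y₀ : Subset n} → IsSmallest G Y₀ → IsSmallest H Y₀ →
                         Feasible G ⊤ → H ⊤ ≡ false → width H < width G
width-drops-without-⊤ {n} {G} {H} {Y₀} sG sH G⊤ H⊤ with largest (λ Y → H Y Bool.≟ true) (proj₁ sH)
... | b , Hb , b≥ = subst₂ _<_ (sym width-H) (sym width-G) (∸-monoˡ-< ∣b∣<n (IsSmallest⇒≤ sH Hb))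
  where
  width-G : width G ≡ n ∸ ∣ Y₀ ∣
  width-G = trans (width-between G (proj₁ sG) G⊤ (λ Y GY → IsSmallest⇒≤ sG GY , p⊆q⇒∣p∣≤∣q∣ (⊆⊤ {p = Y})))
                  (cong (_∸ ∣ Y₀ ∣) (∣⊤∣≡n n))
  width-H : width H ≡ ∣ b ∣ ∸ ∣ Y₀ ∣
  width-H = width-between H (proj₁ sH) Hb (λ Y HY → IsSmallest⇒≤ sH HY , b≥ Y HY)
  ∣b∣<n : ∣ b ∣ < n
  ∣b∣<n = ≢⊤⇒∣∣<n λ b≡⊤ → contradiction (trans (sym H⊤) (subst (Feasible H) b≡⊤ Hb)) λ ()

flipping-⊤-changes-width : {G H : SetSystem n} {Y₀ : Subset n} → IsSmallest G Y₀ → IsSmallest H Y₀ →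
                            H ⊤ ≡ not (G ⊤) → width H ≢ width G
flipping-⊤-changes-width {G = G} sG sH H⊤ with G ⊤ in G⊤
... | true  = <⇒≢ (width-drops-without-⊤ sG sH G⊤ H⊤)
... | false = <⇒≢ (width-drops-without-⊤ sH sG H⊤ G⊤) ∘ sym

-- Sets above a maximal proper feasible set

module AboveMaximal (G : SetSystem n) (X : Subset n) (GX : Feasible G X)
                    (maximal : ∀ Y → Feasible G Y → Y ≢ ⊤ → X ⊆ Y → Y ⊆ X) where

  infix 4 _⊆X∪_
  _⊆X∪_ : Subset n → List (Fin n) → Set
  Y ⊆X∪ L = ∀ {i} → i ∈ Y → i ∈ X ⊎ i ∈ₗ L

  ⊆X∪-weaken : {Y : Subset n} {e : Fin n} {L : List (Fin n)} → Y ⊆X∪ L → Y ⊆X∪ (e ∷ L)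
  ⊆X∪-weaken Y⊆ = Sum.map₂ there ∘ Y⊆

  ⊆X∪-strengthen : {Y : Subset n} {e : Fin n} {L : List (Fin n)} → e ∉ Y → Y ⊆X∪ (e ∷ L) → Y ⊆X∪ L
  ⊆X∪-strengthen e∉Y Y⊆ {i} i∈Y with Y⊆ i∈Y
  ... | inj₁ i∈X         = inj₁ i∈X
  ... | inj₂ (here refl) = contradiction i∈Y e∉Y
  ... | inj₂ (there i∈L) = inj₂ i∈L

  ⊆X∪-∉ : {Y : Subset n} {e : Fin n} {L : List (Fin n)} → e ∉ Y → Y ⊆X∪ L ⇔ Y ⊆X∪ (e ∷ L)
  ⊆X∪-∉ e∉Y = mk⇔ ⊆X∪-weaken (⊆X∪-strengthen e∉Y)

  ⊆X∪-remove : {Y : Subset n} {e : Fin n} {L : List (Fin n)} → Y - e ⊆X∪ L ⇔ Y ⊆X∪ (e ∷ L)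
  ⊆X∪-remove {Y} {e} = mk⇔ to from
    where
    to : ∀ {L} → Y - e ⊆X∪ L → Y ⊆X∪ (e ∷ L)
    to Y-e⊆ {i} i∈Y with i Fin.≟ e
    ... | yes refl = inj₂ (here refl)
    ... | no  i≢e  = ⊆X∪-weaken Y-e⊆ (x∈p∧x≢y⇒x∈p-y i∈Y i≢e)
    from : ∀ {L} → Y ⊆X∪ (e ∷ L) → Y - e ⊆X∪ L
    from Y⊆ = ⊆X∪-strengthen (x∉p-x Y e) (λ i∈Y-e → Y⊆ (p─q⊆p Y ⁅ e ⁆ i∈Y-e))

  private
    ≡⇒⇔ : {a b : Bool} → a ≡ b → a ≡ true ⇔ b ≡ true
    ≡⇒⇔ a≡b = mk⇔ (trans (sym a≡b)) (trans a≡b)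

    ⊆-remove : {Y : Subset n} {e : Fin n} → X ⊆ Y → e ∉ X → X ⊆ Y - e
    ⊆-remove X⊆Y e∉X i∈X = x∈p∧x≢y⇒x∈p-y (X⊆Y i∈X) λ { refl → e∉X i∈X }

  loopcs-above : {L : List (Fin n)} → Unique L → All (_∉ X) L →
                 ∀ {Y} → X ⊆ Y → Y ≢ ⊤ → Feasible (loopcs L G) Y ⇔ Y ⊆X∪ L
  loopcs-above [] [] {Y} X⊆Y Y≢⊤ = mk⇔ (λ GY {i} i∈Y → inj₁ (maximal Y GY Y≢⊤ X⊆Y i∈Y)) covered⇒feasible
    where
    covered⇒feasible : Y ⊆X∪ [] → Feasible G Y
    covered⇒feasible Y⊆ = subst (Feasible G) (⊆-antisym X⊆Y Y⊆X) GX
      where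
      Y⊆X : Y ⊆ X
      Y⊆X i∈Y with Y⊆ i∈Y
      ... | inj₁ i∈X = i∈X
  loopcs-above {e ∷ L} (e∉L ∷ unique) (e∉X ∷ fresh) {Y} X⊆Y Y≢⊤ with e ∈? Y
  ... | yes e∈Y = ⇔.trans (≡⇒⇔ (trans (loopc-∈ H e∈Y) (cong (_xor H (Y - e)) HY≡false)))
                          (⇔.trans (loopcs-above unique fresh (⊆-remove X⊆Y e∉X) (p-x≢⊤ Y e)) ⊆X∪-remove)
    where
    H = loopcs L G
    HY≡false : H Y ≡ false
    HY≡false = ¬-not λ HY →
      Sum.[ e∉X , All¬⇒¬Any e∉L ] (Equivalence.to (loopcs-above unique fresh X⊆Y Y≢⊤) HY e∈Y)
  ... | no e∉Y = ⇔.trans (≡⇒⇔ (loopc-∉ (loopcs L G) e∉Y))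
                         (⇔.trans (loopcs-above unique fresh X⊆Y Y≢⊤) (⊆X∪-∉ e∉Y))

  private
    ⊤-e-feasible : {L : List (Fin n)} {e : Fin n} → Unique L → All (_∉ X) L → e ∉ X →
                   Feasible (loopcs L G) (⊤ - e) ⇔ ⊤ ⊆X∪ (e ∷ L)
    ⊤-e-feasible {e = e} unique fresh e∉X =
      ⇔.trans (loopcs-above unique fresh (⊆-remove ⊆⊤ e∉X) (p-x≢⊤ ⊤ e)) ⊆X∪-remove

  loopcs-⊤-unchanged : {L : List (Fin n)} → Unique L → All (_∉ X) L → ¬ ⊤ ⊆X∪ L → loopcs L G ⊤ ≡ G ⊤
  loopcs-⊤-unchanged {[]}    _            _             _      = refl
  loopcs-⊤-unchanged {e ∷ L} (_ ∷ unique) (e∉X ∷ fresh) ¬cover = begin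
    loopc e H ⊤        ≡⟨ loopc-∈ H ∈⊤ ⟩
    H ⊤ xor H (⊤ - e)  ≡⟨ cong₂ _xor_ (loopcs-⊤-unchanged unique fresh (¬cover ∘ ⊆X∪-weaken))
                                      (¬-not (¬cover ∘ Equivalence.to (⊤-e-feasible unique fresh e∉X))) ⟩
    G ⊤ xor false      ≡⟨ xor-identityʳ (G ⊤) ⟩
    G ⊤                ∎
    where
    open ≡-Reasoning
    H = loopcs L G

  loopcs-⊤-flipped : {L : List (Fin n)} → X ≢ ⊤ → Unique L → All (_∉ X) L → ⊤ ⊆X∪ L →
                     loopcs L G ⊤ ≡ not (G ⊤)
  loopcs-⊤-flipped {[]} X≢⊤ _ _ cover = contradiction (⊆-antisym ⊆⊤ ⊤⊆X) X≢⊤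
    where
    ⊤⊆X : ⊤ ⊆ X
    ⊤⊆X i∈⊤ with cover i∈⊤
    ... | inj₁ i∈X = i∈X
  loopcs-⊤-flipped {e ∷ L} X≢⊤ (e∉L ∷ unique) (e∉X ∷ fresh) cover = begin
    loopc e H ⊤        ≡⟨ loopc-∈ H ∈⊤ ⟩
    H ⊤ xor H (⊤ - e)  ≡⟨ cong₂ _xor_ (loopcs-⊤-unchanged unique fresh ¬coverL)
                                      (Equivalence.from (⊤-e-feasible unique fresh e∉X) cover) ⟩
    G ⊤ xor true       ≡⟨ xor-comm (G ⊤) true ⟩
    not (G ⊤)          ∎
    where
    open ≡-Reasoning
    H = loopcs L G
    ¬coverL : ¬ ⊤ ⊆X∪ L
    ¬coverL cover′ = Sum.[ e∉X , All¬⇒¬Any e∉L ] (cover′ ∈⊤)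

  loopcs-outside-flip-⊤ : X ≢ ⊤ → loopcs (reverse (elems (∁ X))) G ⊤ ≡ not (G ⊤)
  loopcs-outside-flip-⊤ X≢⊤ =
    loopcs-⊤-flipped X≢⊤ (unique-reverse (unique-elems (∁ X)))
      (All.tabulate λ i∈ → x∈∁p⇒x∉p (Equivalence.from ∈-elems (Any.reverse⁻ i∈))) cover
    where
    cover : ⊤ ⊆X∪ reverse (elems (∁ X))
    cover {i} _ with i ∈? X
    ... | yes i∈X = inj₁ i∈X
    ... | no  i∉X = inj₂ (Any.reverse⁺ (Equivalence.to ∈-elems (x∉p⇒x∈∁p i∉X)))

loopc-fixes-only-⊤ : {F : SetSystem n} → IsSingletonFamily F ⊤ → ∀ e Y → loopc e F Y ≡ F Y
loopc-fixes-only-⊤ {F = F} only-⊤ e Y with e ∈? Y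
... | yes e∈Y = begin
  loopc e F Y          ≡⟨ loopc-∈ F e∈Y ⟩
  F Y xor F (Y - e)    ≡⟨ cong (F Y xor_) (¬-not (p-x≢⊤ Y e ∘ proj₁ (only-⊤ (Y - e)))) ⟩
  F Y xor false        ≡⟨ xor-identityʳ (F Y) ⟩
  F Y                  ∎
  where open ≡-Reasoning
... | no  e∉Y = loopc-∉ F e∉Y

loopcs-fix-only-⊤ : {F : SetSystem n} → IsSingletonFamily F ⊤ → ∀ L Y → loopcs L F Y ≡ F Y
loopcs-fix-only-⊤ only-⊤ []      Y = refl
loopcs-fix-only-⊤ only-⊤ (e ∷ L) Y =
  trans (loopc-cong e (loopcs-fix-only-⊤ only-⊤ L) Y) (loopc-fixes-only-⊤ only-⊤ e Y)

proper-feasible⇒loop-width-varies : (F : SetSystem n) {X₁ : Subset n} → Feasible F X₁ → X₁ ≢ ⊤ →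
  ∃[ A ] width (applyWordSet (`× ∷ []) A F) ≢ width F
proper-feasible⇒loop-width-varies F FX₁ X₁≢⊤
  with largest (λ Y → (F Y Bool.≟ true) ×-dec ¬? (Y ≟ₛ ⊤)) (FX₁ , X₁≢⊤)
     | smallest-feasible F (_ , FX₁)
... | X , (FX , X≢⊤) , X-largest | Y₀ , sF =
  -- applyWordSet (`× ∷ []) (∁ X) F unfolds to loopcs L F.
  ∁ X , flipping-⊤-changes-width sF (loopcs-IsSmallest L sF) (loopcs-outside-flip-⊤ X≢⊤)
  where
  L = reverse (elems (∁ X))
  maximal : ∀ Y → Feasible F Y → Y ≢ ⊤ → X ⊆ Y → Y ⊆ X
  maximal Y FY Y≢⊤ X⊆Y {i} i∈Y with i ∈? X
  ... | yes i∈X = i∈X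
  ... | no  i∉X = contradiction (X-largest Y (FY , Y≢⊤)) (<⇒≱ (p⊂q⇒∣p∣<∣q∣ (X⊆Y , i , i∈Y , i∉X)))
  open AboveMaximal F X FX maximal

loop-width-constant⇔only-⊤ : (F : SetSystem n) → ∃[ X ] Feasible F X →
  (∀ A → width (applyWordSet (`× ∷ []) A F) ≡ width F) ⇔ IsSingletonFamily F ⊤
loop-width-constant⇔only-⊤ F (X₀ , FX₀) =
  mk⇔ only-⊤ λ only A → width-cong (loopcs-fix-only-⊤ only (reverse (elems A)))
  where
  only-⊤ : (∀ A → width (applyWordSet (`× ∷ []) A F) ≡ width F) → IsSingletonFamily F ⊤
  only-⊤ constant = λ X → is-⊤ X , λ { refl → subst (Feasible F) (is-⊤ X₀ FX₀) FX₀ }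
    where
    is-⊤ : ∀ X → Feasible F X → X ≡ ⊤
    is-⊤ X FX with X ≟ₛ ⊤
    ... | yes X≡⊤ = X≡⊤
    ... | no  X≢⊤ with proper-feasible⇒loop-width-varies F FX X≢⊤
    ...   | A , varies = contradiction (constant A) varies

-- Duality

-- D^{*|E}: its feasible sets are the complements of those of F.
dual : SetSystem n → SetSystem n
dual F = F ∘ ∁

dual-feasible : (F : SetSystem n) {X : Subset n} → Feasible F X → Feasible (dual F) (∁ X)
dual-feasible F {X} FX = subst (Feasible F) (sym (∁-involutive X)) FX

*×* : Word
*×* = `* ∷ `× ∷ `* ∷ []

lookup-⁅e⁆Δ∁ : (Y : Subset n) (e : Fin n) → lookup (⁅ e ⁆ Δ ∁ Y) e ≡ lookup Y e
lookup-⁅e⁆Δ∁ (y ∷ Y) zero    = not-involutive y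
lookup-⁅e⁆Δ∁ (y ∷ Y) (suc e) = lookup-⁅e⁆Δ∁ Y e

⁅e⁆Δ-updateAt-⁅e⁆Δ∁ : (Y : Subset n) (e : Fin n) →
  ⁅ e ⁆ Δ updateAt (⁅ e ⁆ Δ ∁ Y) e (λ _ → false) ≡ ∁ (updateAt Y e (λ _ → false))
⁅e⁆Δ-updateAt-⁅e⁆Δ∁ (y ∷ Y) zero    = cong (true ∷_) (Δ-cancelˡ ⊥ (∁ Y))
⁅e⁆Δ-updateAt-⁅e⁆Δ∁ (y ∷ Y) (suc e) = cong (not y ∷_) (⁅e⁆Δ-updateAt-⁅e⁆Δ∁ Y e)

dual-*×*-at : (e : Fin n) (F : SetSystem n) →
  ∀ Y → dual (applyWordAt *×* e F) Y ≡ loopc e (dual F) Y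
dual-*×*-at e F Y =
  trans (cong₂ (λ b Z → if b then F Z xor F W else F Z) (lookup-⁅e⁆Δ∁ Y e) (Δ-cancelˡ ⁅ e ⁆ (∁ Y)))
        (cong (λ Z → if lookup Y e then F (∁ Y) xor F Z else F (∁ Y)) (⁅e⁆Δ-updateAt-⁅e⁆Δ∁ Y e))
  where
  W = ⁅ e ⁆ Δ updateAt (⁅ e ⁆ Δ ∁ Y) e (λ _ → false)

dual-*×*-set : (A : Subset n) (F : SetSystem n) →
  ∀ Y → dual (applyWordSet *×* A F) Y ≡ applyWordSet (`× ∷ []) A (dual F) Y
dual-*×*-set A F = along (reverse (elems A))
  where
  along : ∀ L Y → dual (foldr (applyWordAt *×*) F L) Y ≡ loopcs L (dual F) Y
  along []      Y = refl
  along (e ∷ L) Y = trans (dual-*×*-at e (foldr (applyWordAt *×*) F L) Y) (loopc-cong e (along L) Y)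

width-dual : (G : SetSystem n) → width (dual G) ≡ width G
width-dual {n} G with anySubset? (λ X → G X Bool.≟ true)
... | no ∄X = trans (width-empty (dual G) λ X GX → ∄X (∁ X , GX)) (sym (width-empty G λ X GX → ∄X (X , GX)))
... | yes (X , GX) with smallest (λ Y → G Y Bool.≟ true) GX | largest (λ Y → G Y Bool.≟ true) GX
...   | a , Ga , a≤ | b , Gb , ≤b = begin
  width (dual G)              ≡⟨ width-between (dual G) (dual-feasible G Gb) (dual-feasible G Ga) dual-bounds ⟩
  ∣ ∁ a ∣ ∸ ∣ ∁ b ∣           ≡⟨ cong₂ _∸_ (∣∁p∣≡n∸∣p∣ a) (∣∁p∣≡n∸∣p∣ b) ⟩
  (n ∸ ∣ a ∣) ∸ (n ∸ ∣ b ∣)   ≡⟨ [m∸n]∸[m∸o]≡o∸n (a≤ b Gb) (∣p∣≤n b) ⟩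
  ∣ b ∣ ∸ ∣ a ∣               ≡⟨ sym (width-between G Ga Gb λ Y GY → a≤ Y GY , ≤b Y GY) ⟩
  width G                     ∎
  where
  open ≡-Reasoning
  ∣∣≡∣∁∁∣ : ∀ Y → ∣ Y ∣ ≡ ∣ ∁ (∁ Y) ∣
  ∣∣≡∣∁∁∣ Y = cong ∣_∣ (sym (∁-involutive Y))
  dual-bounds : ∀ Y → Feasible (dual G) Y → ∣ ∁ b ∣ ≤ ∣ Y ∣ × ∣ Y ∣ ≤ ∣ ∁ a ∣
  dual-bounds Y G∁Y = subst (∣ ∁ b ∣ ≤_) (sym (∣∣≡∣∁∁∣ Y)) (∣∁∣-antitone (∁ Y) b (≤b (∁ Y) G∁Y)) ,
                      subst (_≤ ∣ ∁ a ∣) (sym (∣∣≡∣∁∁∣ Y)) (∣∁∣-antitone a (∁ Y) (a≤ (∁ Y) G∁Y))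

*×*-width-constant⇔dual : (F : SetSystem n) →
  (∀ A → width (applyWordSet *×* A F) ≡ width F) ⇔
  (∀ A → width (applyWordSet (`× ∷ []) A (dual F)) ≡ width (dual F))
*×*-width-constant⇔dual F = mk⇔
  (λ constant A → trans (sym (*×*≡ A)) (trans (constant A) (sym (width-dual F))))
  (λ constant A → trans (*×*≡ A) (trans (constant A) (width-dual F)))
  where
  *×*≡ : ∀ A → width (applyWordSet *×* A F) ≡ width (applyWordSet (`× ∷ []) A (dual F))
  *×*≡ A = trans (sym (width-dual (applyWordSet *×* A F))) (width-cong (dual-*×*-set A F))

only-S⇔dual-only-∁S : (F : SetSystem n) (S : Subset n) →
                      IsSingletonFamily F S ⇔ IsSingletonFamily (dual F) (∁ S)
only-S⇔dual-only-∁S F S = mk⇔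
  (λ only X → (λ F∁X → trans (sym (∁-involutive X)) (cong ∁ (proj₁ (only (∁ X)) F∁X))) ,
              λ { refl → subst (Feasible F) (sym (∁-involutive S)) (proj₂ (only S) refl) })
  (λ only X → (λ FX → ∁-injective (proj₁ (only (∁ X)) (dual-feasible F FX))) ,
              λ { refl → subst (Feasible F) (∁-involutive S) (proj₂ (only (∁ S)) refl) })

mainTheorem10 : ∀ (n : ℕ) (F : SetSystem n) → VfSafe F →
    (IsMonomial (partialWidthPoly (`× ∷ []) F) ⇔ IsSingletonFamily F ⊤)
    × (IsMonomial (partialWidthPoly (`* ∷ `× ∷ `* ∷ []) F) ⇔ IsSingletonFamily F ⊥)
mainTheorem10 n F vf =
  ⇔.trans (monomial⇔constant-width (`× ∷ []) F) (loop-width-constant⇔only-⊤ F nonempty) ,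
  ⇔.trans (monomial⇔constant-width *×* F)
    (⇔.trans (*×*-width-constant⇔dual F)
      (⇔.trans (loop-width-constant⇔only-⊤ (dual F) dual-nonempty) dual-only-⊤⇔only-⊥))
  where
  nonempty : ∃[ X ] Feasible F X
  nonempty = proj₁ (vf [])
  dual-nonempty : ∃[ X ] Feasible (dual F) X
  dual-nonempty = ∁ (proj₁ nonempty) , dual-feasible F (proj₂ nonempty)
  dual-only-⊤⇔only-⊥ : IsSingletonFamily (dual F) ⊤ ⇔ IsSingletonFamily F ⊥
  dual-only-⊤⇔only-⊥ =
    ⇔.sym (subst (λ S → IsSingletonFamily F ⊥ ⇔ IsSingletonFamily (dual F) S) ∁⊥≡⊤ (only-S⇔dual-only-∁S F ⊥))
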